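{- For every integer $n \ge 9$ of the form $n = 5k + 4$ with $k \in \mathbb{N}$, we have $\mathbf{max\text{ - }diam}(n, 2) \ge 4^{(n - 4)/5}$.
   Context: A partial deterministic finite semi-automaton (partial DFA) is a triple $\mathcal{A} = (Q, \Sigma, \delta)$ with $Q$ a finite set of states, $\Sigma$ a finite alphabet, and $\delta \colon Q \times \Sigma \rightharpoonup Q$ a partial transition function, extended to words in the usual way (undefined if any step is undefined). Each word $w$ thus expresses a partial transformation $q \mapsto \delta(q, w)$ of $Q$. The depth of a partial transformation $f$ expressed by some word is the length of a shortest word expressing $f$. The diameter of $\mathcal{A}$ is the maximum depth over all partial transformations of $Q$ expressed by some word in $\mathcal{A}$ (equivalently, the smallest $\ell \ge 0$ such that words of length at most $\ell$ express all transformations expressed by words). $\mathbf{max\text{ - }diam}(n, m)$ denotes the maximum of the diameters of partial DFAs with $n$ states and $m$ letters. -}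

module Defs where

open import Data.Nat using (ℕ; _≤_)
open import Data.Fin using (Fin)
open import Data.Maybe using (Maybe; just; nothing)
open import Data.List using (List; []; _∷_; length)
open import Data.Product using (Σ; ∃; _×_)
open import Relation.Binary.PropositionalEquality using (_≡_)

record PDFA (n m : ℕ) : Set where
  constructor pdfa
  field
    δ : Fin n → Fin m → Maybe (Fin n)

open PDFA public

Word : ℕ → Set
Word m = List (Fin m)

δ* : ∀ {n m} → PDFA n m → Fin n → Word m → Maybe (Fin n)
δ* A q []      = just q
δ* A q (a ∷ w) with δ A q a
... | nothing = nothing
... | just p  = δ* A p w

PTrans : ℕ → Set
PTrans n = Fin n → Maybe (Fin n)

⟦_⟧ : ∀ {n m} → PDFA n m → Word m → PTrans n
⟦ A ⟧ w q = δ* A q w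

Expresses : ∀ {n m} → PDFA n m → Word m → PTrans n → Set
Expresses A w f = ∀ q → ⟦ A ⟧ w q ≡ f q

-- depth(f) ≥ d, for f expressed by some word: every word expressing f
-- has length at least d (depth = length of a shortest expressing word).
DepthAtLeast : ∀ {n m} → PDFA n m → PTrans n → ℕ → Set
DepthAtLeast A f d = ∀ (u : Word _) → Expresses A u f → d ≤ length u

-- diameter(A) ≥ d: some partial transformation expressed by a word of A
-- has depth at least d (diameter = max depth over expressed transformations).
DiameterAtLeast : ∀ {n m} → PDFA n m → ℕ → Set
DiameterAtLeast A d = Σ (Word _) λ w → DepthAtLeast A (⟦ A ⟧ w) d

MaxDiamAtLeast : ℕ → ℕ → ℕ → Set
MaxDiamAtLeast n m d = Σ (PDFA n m) λ A → DiameterAtLeast A d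

{-# OPTIONS --safe #-}
-- States are pairs (p , x) of a phase p ≤ k and a digit x ≤ 4, except (k , 4), so there are 5k + 4.
-- Letter a rotates the phase modulo k + 1; letter b raises the digit in phase 0 (but not beyond 4),
-- resets digit 4 to 0 in phase 1 (and is undefined there otherwise), and fixes the other phases.
--
-- Put token j < k in state (−j mod (k + 1) , 0). Under any word the phases of the tokens stay
-- aligned: token j is in phase c − j for a common c. Hence b adds at most 4^c to the potential
-- Σ_j x_j 4^j of the tokens' digits, but when c ≥ 1 it also clears the digit 4 of token c − 1,
-- worth 4^c: every letter raises the potential by at most 1. The word W (k − 1) brings token
-- k − 1 to digit 4, i.e. to potential at least 4^k, so no shorter word acts like it on the tokens.
module Submission where

open import Defs
open import Data.Nat using (ℕ; zero; suc; _+_; _*_; _∸_; _^_; _≤_; _<_; z≤n; s≤s; s≤s⁻¹; z<s; s<s; _<?_; _≟_; NonZero)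
open import Data.Nat.Properties
open import Data.Nat.DivMod
open import Data.Fin using (Fin; zero; suc; toℕ; fromℕ<)
open import Data.Fin.Properties using (toℕ<n; toℕ-fromℕ<)
open import Data.Nat.Divisibility using (n∣m*n)
open import Function using (_∘_)
open import Data.Maybe using (Maybe; just; nothing; _>>=_; fromMaybe)
open import Data.Maybe.Properties using (just-injective)
open import Data.List using ([]; _∷_; _++_; length; replicate)
open import Data.Product using (∃; _×_; _,_; proj₁; proj₂)
open import Data.Sum using (_⊎_; inj₁; inj₂)
open import Relation.Nullary using (yes; no; contradiction)
open import Relation.Binary.PropositionalEquality
open import Relation.Binary.Definitions using (tri<; tri≈; tri>)
open import Algebra.Properties.CommutativeSemigroup +-commutativeSemigroup using (xy∙z≈xz∙y)

weightedSum : ℕ → ℕ → (ℕ → ℕ) → ℕ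
weightedSum b zero    f = 0
weightedSum b (suc m) f = weightedSum b m f + f m * b ^ m

module _ {b : ℕ} where

  weightedSum-zero : ∀ m {f} → (∀ j → j < m → f j ≡ 0) → weightedSum b m f ≡ 0
  weightedSum-zero zero    f≡0 = refl
  weightedSum-zero (suc m) f≡0
    rewrite weightedSum-zero m (λ j j<m → f≡0 j (m<n⇒m<1+n j<m)) | f≡0 m ≤-refl = refl

  weightedSum-mono : ∀ m {f g} → (∀ j → j < m → g j ≤ f j) → weightedSum b m g ≤ weightedSum b m f
  weightedSum-mono zero    g≤f = z≤n
  weightedSum-mono (suc m) g≤f =
    +-mono-≤ (weightedSum-mono m (λ j j<m → g≤f j (m<n⇒m<1+n j<m))) (*-monoˡ-≤ _ (g≤f m ≤-refl))

  weightedSum-mono-from : ∀ {m₀ m f g e} → m₀ ≤ m → (∀ j → m₀ ≤ j → j < m → g j ≤ f j) →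
                          weightedSum b m₀ g ≤ weightedSum b m₀ f + e →
                          weightedSum b m g ≤ weightedSum b m f + e
  weightedSum-mono-from {m = zero} z≤n g≤f base = base
  weightedSum-mono-from {m₀} {suc m} {f} {g} {e} m₀≤1+m g≤f base with m≤n⇒m<n∨m≡n m₀≤1+m
  ... | inj₂ refl = base
  ... | inj₁ m₀≤m = begin
    weightedSum b m g + g m * b ^ m
      ≤⟨ +-mono-≤ (weightedSum-mono-from (s≤s⁻¹ m₀≤m) (λ j m₀≤j j<m → g≤f j m₀≤j (m<n⇒m<1+n j<m)) base)
                  (*-monoˡ-≤ _ (g≤f m (s≤s⁻¹ m₀≤m) ≤-refl)) ⟩
    weightedSum b m f + e + f m * b ^ m
      ≡⟨ xy∙z≈xz∙y (weightedSum b m f) e _ ⟩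
    weightedSum b m f + f m * b ^ m + e ∎
    where open ≤-Reasoning

  weightedSum-absorbs-carry : ∀ c {f g} → (∀ j → j < c → g j ≤ f j) →
                              (∀ c′ → suc c′ ≡ c → f c′ ≡ b × g c′ ≡ 0) →
                              weightedSum b c g + b ^ c ≤ weightedSum b c f + 1
  weightedSum-absorbs-carry zero     g≤f carry = ≤-refl
  weightedSum-absorbs-carry (suc c′) {f} {g} g≤f carry with carry c′ refl
  ... | fc′≡b , gc′≡0 = begin
    weightedSum b c′ g + g c′ * b ^ c′ + b ^ suc c′ ≡⟨ cong (λ x → weightedSum b c′ g + x * b ^ c′ + b ^ suc c′)
                                                           gc′≡0 ⟩
    weightedSum b c′ g + 0 + b ^ suc c′            ≡⟨ cong (_+ b ^ suc c′) (+-identityʳ _) ⟩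
    weightedSum b c′ g + b * b ^ c′                ≤⟨ +-mono-≤ (weightedSum-mono c′ (λ j j<c′ → g≤f j (m<n⇒m<1+n j<c′)))
                                                                (≤-reflexive (cong (_* b ^ c′) (sym fc′≡b))) ⟩
    weightedSum b c′ f + f c′ * b ^ c′             ≤⟨ m≤m+n _ 1 ⟩
    weightedSum b c′ f + f c′ * b ^ c′ + 1         ∎
    where open ≤-Reasoning

  weightedSum-carry : ∀ {m c f g} → (∀ j → j < m → g j ≤ suc (f j)) →
                      (∀ j → j < m → j ≢ c → g j ≤ f j) →
                      (∀ c′ → suc c′ ≡ c → c′ < m → f c′ ≡ b × g c′ ≡ 0) →
                      weightedSum b m g ≤ weightedSum b m f + 1
  weightedSum-carry {m} {c} {f} {g} g≤1+f g≤f carry with <-cmp c m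
  ... | tri> _ _ m<c = ≤-trans (weightedSum-mono m (λ j j<m → g≤f j j<m (λ { refl → <-asym j<m m<c })))
                               (m≤m+n _ 1)
  ... | tri≈ _ refl _ =
    ≤-trans (m≤m+n _ _) (weightedSum-absorbs-carry c (λ j j<c → g≤f j j<c (<⇒≢ j<c))
                                                    (λ c′ eq → carry c′ eq (≤-reflexive eq)))
  ... | tri< c<m _ _ =
    weightedSum-mono-from c<m (λ j c<j j<m → g≤f j j<m (≢-sym (<⇒≢ c<j))) (begin
      weightedSum b c g + g c * b ^ c           ≤⟨ +-monoʳ-≤ _ (*-monoˡ-≤ (b ^ c) (g≤1+f c c<m)) ⟩
      weightedSum b c g + (b ^ c + f c * b ^ c) ≡⟨ +-assoc (weightedSum b c g) _ _ ⟨
      weightedSum b c g + b ^ c + f c * b ^ c   ≤⟨ +-monoˡ-≤ _ (weightedSum-absorbs-carry c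
                                                      (λ j j<c → g≤f j (<-trans j<c c<m) (<⇒≢ j<c))
                                                      (λ c′ eq → carry c′ eq (<-trans (≤-reflexive eq) c<m))) ⟩
      weightedSum b c f + 1 + f c * b ^ c       ≡⟨ xy∙z≈xz∙y (weightedSum b c f) 1 _ ⟩
      weightedSum b c f + f c * b ^ c + 1       ∎)
    where open ≤-Reasoning

%-absorbˡ : ∀ m n d .{{_ : NonZero d}} → (m % d + n) % d ≡ (m + n) % d
%-absorbˡ m n d = begin
  (m % d + n) % d         ≡⟨ %-distribˡ-+ (m % d) n d ⟩
  (m % d % d + n % d) % d ≡⟨ cong (λ r → (r + n % d) % d) (m%n%n≡m%n m d) ⟩
  (m % d + n % d) % d     ≡⟨ %-distribˡ-+ m n d ⟨
  (m + n) % d             ∎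
  where open ≡-Reasoning

%-absorbʳ : ∀ m n d .{{_ : NonZero d}} → (m + n % d) % d ≡ (m + n) % d
%-absorbʳ m n d = begin
  (m + n % d) % d ≡⟨ cong (_% d) (+-comm m (n % d)) ⟩
  (n % d + m) % d ≡⟨ %-absorbˡ n m d ⟩
  (n + m) % d     ≡⟨ cong (_% d) (+-comm n m) ⟩
  (m + n) % d     ∎
  where open ≡-Reasoning

%-wrap : ∀ {m n} .{{_ : NonZero n}} → m < n + n → m % n ≡ m ⊎ m % n + n ≡ m
%-wrap {m} {n} m<2n with m <? n
... | yes m<n = inj₁ (m<n⇒m%n≡m m<n)
... | no m≮n = inj₂ (begin
  m % n + n       ≡⟨ cong (_+ n) (m≤n⇒[n∸m]%m≡n%m n≤m) ⟨
  (m ∸ n) % n + n ≡⟨ cong (_+ n) (m<n⇒m%n≡m (m<n+o⇒m∸n<o m n m<2n)) ⟩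
  m ∸ n + n       ≡⟨ m∸n+n≡m n≤m ⟩
  m               ∎)
  where
  open ≡-Reasoning
  n≤m : n ≤ m
  n≤m = ≮⇒≥ m≮n

next : ∀ {n m} → PDFA n m → Fin m → Fin n → Fin n
next A l q = fromMaybe q (δ A q l)

module _ {n m} {A : PDFA n m} where

  δ*-∷ : ∀ {q l p u} → δ A q l ≡ just p → δ* A q (l ∷ u) ≡ δ* A p u
  δ*-∷ δql≡p rewrite δql≡p = refl

  δ*-∷⁻¹ : ∀ q l {u r} → δ* A q (l ∷ u) ≡ just r →
           δ A q l ≡ just (next A l q) × δ* A (next A l q) u ≡ just r
  δ*-∷⁻¹ q l run with δ A q l
  ... | just p = refl , run

module Encoded {S : Set} {n m} (δ₀ : S → Fin m → Maybe S)
               (encode : S → Maybe (Fin n)) (decode : Fin n → S)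
               (decode-encode : ∀ {s q} → encode s ≡ just q → decode q ≡ s) where

  automaton : PDFA n m
  automaton = pdfa λ q l → δ₀ (decode q) l >>= encode

  decode-δ : ∀ q l {q′} → δ automaton q l ≡ just q′ → δ₀ (decode q) l ≡ just (decode q′)
  decode-δ q l step with δ₀ (decode q) l
  ... | just t = cong just (sym (decode-encode step))

  encode-δ : ∀ {s t q q′ l} → encode s ≡ just q → δ₀ s l ≡ just t → encode t ≡ just q′ →
             δ automaton q l ≡ just q′
  encode-δ {s} {t} {q} {q′} {l} es≡q step et≡q′ = begin
    (δ₀ (decode q) l >>= encode) ≡⟨ cong (λ s → δ₀ s l >>= encode) (decode-encode es≡q) ⟩
    (δ₀ s l >>= encode)          ≡⟨ cong (_>>= encode) step ⟩
    encode t                     ≡⟨ et≡q′ ⟩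
    just q′                      ∎
    where open ≡-Reasoning

  Encodable : S → Set
  Encodable s = ∃ λ q → encode s ≡ just q

  Step : S → Fin m → S → Set
  Step s l t = δ₀ s l ≡ just t × Encodable t

  infixr 5 _◅_ _◅◅_
  data _⟶[_]_ : S → Word m → S → Set where
    ε   : ∀ {s} → s ⟶[ [] ] s
    _◅_ : ∀ {s l t u r} → Step s l t → t ⟶[ u ] r → s ⟶[ l ∷ u ] r

  _◅◅_ : ∀ {s t r u v} → s ⟶[ u ] t → t ⟶[ v ] r → s ⟶[ u ++ v ] r
  ε            ◅◅ path′ = path′
  (step ◅ path) ◅◅ path′ = step ◅ (path ◅◅ path′)

  _▸_ : ∀ {s t t′ u} → s ⟶[ u ] t → t ≡ t′ → s ⟶[ u ] t′
  path ▸ refl = path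

  ⟶⇒δ* : ∀ {s t u q r} → s ⟶[ u ] t → encode s ≡ just q → encode t ≡ just r →
         δ* automaton q u ≡ just r
  ⟶⇒δ* ε es≡q es≡r = trans (sym es≡q) es≡r
  ⟶⇒δ* ((step , q′ , et≡q′) ◅ path) es≡q er≡r =
    trans (δ*-∷ {A = automaton} (encode-δ es≡q step et≡q′)) (⟶⇒δ* path et≡q′ er≡r)

module Construction (k : ℕ) where

  pattern a = zero
  pattern b = suc zero

  rotate : ℕ → ℕ
  rotate p = suc p % suc k

  rotate-< : ∀ {p} → p < k → rotate p ≡ suc p
  rotate-< p<k = m<n⇒m%n≡m (s≤s p<k)

  rotate-top : rotate k ≡ 0
  rotate-top = n%n≡0 (suc k)

  rotate-≤ : ∀ p → rotate p ≤ k
  rotate-≤ p = s≤s⁻¹ (m%n<n (suc p) (suc k))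

  %-full-turn : ∀ {p} → p ≤ k → (p + suc k) % suc k ≡ p
  %-full-turn {p} p≤k = trans ([m+n]%n≡m%n p (suc k)) (m≤n⇒m%n≡m p≤k)

  phase digit : ℕ × ℕ → ℕ
  phase = proj₁
  digit = proj₂

  δ₀ : ℕ × ℕ → Fin 2 → Maybe (ℕ × ℕ)
  δ₀ (p , x) a = just (rotate p , x)
  δ₀ (0 , x) b with x <? 4
  ... | yes _ = just (0 , suc x)
  ... | no  _ = nothing
  δ₀ (1 , x) b with x ≟ 4
  ... | yes _ = just (1 , 0)
  ... | no  _ = nothing
  δ₀ (suc (suc p) , x) b = just (suc (suc p) , x)

  N : ℕ
  N = 5 * k + 4

  N<[1+k]*5 : N < suc k * 5
  N<[1+k]*5 = begin-strict
    5 * k + 4 <⟨ +-monoʳ-< (5 * k) (n<1+n 4) ⟩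
    5 * k + 5 ≡⟨ +-comm (5 * k) 5 ⟩
    5 + 5 * k ≡⟨ cong (5 +_) (*-comm 5 k) ⟩
    suc k * 5 ∎
    where open ≤-Reasoning

  encode : ℕ × ℕ → Maybe (Fin N)
  encode (p , x) with x <? 5 | x + p * 5 <? N
  ... | yes _ | yes code<N = just (fromℕ< code<N)
  ... | _     | _          = nothing

  decode : Fin N → ℕ × ℕ
  decode q = toℕ q / 5 , toℕ q % 5

  decode-encode : ∀ {s q} → encode s ≡ just q → decode q ≡ s
  decode-encode {p , x} _ with x <? 5 | x + p * 5 <? N
  decode-encode {p , x} refl | yes x<5 | yes code<N rewrite toℕ-fromℕ< code<N =
    cong₂ _,_ quotient remainder
    where
    open ≡-Reasoning
    quotient : (x + p * 5) / 5 ≡ p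
    quotient = begin
      (x + p * 5) / 5   ≡⟨ +-distrib-/-∣ʳ x (n∣m*n p) ⟩
      x / 5 + p * 5 / 5 ≡⟨ cong₂ _+_ (m<n⇒m/n≡0 x<5) (m*n/n≡m p 5) ⟩
      p                 ∎
    remainder : (x + p * 5) % 5 ≡ x
    remainder = trans ([m+kn]%n≡m%n x p 5) (m<n⇒m%n≡m x<5)

  decode-phase-≤ : ∀ q → phase (decode q) ≤ k
  decode-phase-≤ q = s≤s⁻¹ (m<n*o⇒m/o<n (<-trans (toℕ<n q) N<[1+k]*5))

  open Encoded δ₀ encode decode decode-encode public

  encodable : ∀ {p x} → x < 5 → x + p * 5 < N → Encodable (p , x)
  encodable {p} {x} x<5 code<N with x <? 5 | x + p * 5 <? N
  ... | yes _  | yes code<N′ = fromℕ< code<N′ , refl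
  ... | no x≮5 | _           = contradiction x<5 x≮5
  ... | yes _  | no code≮N   = contradiction code<N code≮N

  encodable-top : ∀ {p x} → p ≤ k → x < 4 → Encodable (p , x)
  encodable-top {p} {x} p≤k x<4 = encodable (m<n⇒m<1+n x<4) (begin-strict
    x + p * 5 <⟨ +-mono-<-≤ x<4 (*-monoˡ-≤ 5 p≤k) ⟩
    4 + k * 5 ≡⟨ +-comm 4 (k * 5) ⟩
    k * 5 + 4 ≡⟨ cong (_+ 4) (*-comm k 5) ⟩
    N         ∎)
    where open ≤-Reasoning

  encodable-below : ∀ {p x} → p < k → x < 5 → Encodable (p , x)
  encodable-below {p} {x} p<k x<5 = encodable x<5 (begin-strict
    x + p * 5 <⟨ +-monoˡ-< (p * 5) x<5 ⟩
    suc p * 5 ≤⟨ *-monoˡ-≤ 5 p<k ⟩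
    k * 5     ≡⟨ *-comm k 5 ⟩
    5 * k     ≤⟨ m≤m+n (5 * k) 4 ⟩
    N         ∎)
    where open ≤-Reasoning

  a-step : ∀ {p x} → p < k → Encodable (suc p , x) → Step (p , x) a (suc p , x)
  a-step {x = x} p<k enc = cong (λ r → just (r , x)) (rotate-< p<k) , enc

  a-wrap : ∀ {x} → x < 4 → Step (k , x) a (0 , x)
  a-wrap {x} x<4 = cong (λ r → just (r , x)) rotate-top , encodable-top z≤n x<4

  b-count : ∀ {x} → 0 < k → x < 4 → Step (0 , x) b (0 , suc x)
  b-count {x} 0<k x<4 with x <? 4
  ... | yes _  = refl , encodable-below 0<k (s≤s x<4)
  ... | no x≮4 = contradiction x<4 x≮4

  b-reset : 1 ≤ k → Step (1 , 4) b (1 , 0)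
  b-reset 1≤k = refl , encodable-top 1≤k z<s

  b-stay : ∀ {p x} → 2 ≤ p → Encodable (p , x) → Step (p , x) b (p , x)
  b-stay (s≤s (s≤s _)) enc = refl , enc

  a^ : ℕ → Word 2
  a^ m = replicate m a

  a^-path : ∀ m {p x r} → p ≤ k → x < 4 → (p + m) % suc k ≡ r → (p , x) ⟶[ a^ m ] (r , x)
  a^-path zero {p} {x} p≤k x<4 p%≡r =
    ε ▸ cong (_, x) (trans (sym (m≤n⇒m%n≡m p≤k)) (trans (cong (_% suc k) (sym (+-identityʳ p))) p%≡r))
  a^-path (suc m) {p} p≤k x<4 p+m%≡r =
    (refl , encodable-top (rotate-≤ p) x<4) ◅ a^-path m (rotate-≤ p) x<4 (begin
      (rotate p + m) % suc k ≡⟨ %-absorbˡ (suc p) m (suc k) ⟩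
      suc (p + m) % suc k    ≡⟨ cong (_% suc k) (+-suc p m) ⟨
      (p + suc m) % suc k    ≡⟨ p+m%≡r ⟩
      _                      ∎)
    where open ≡-Reasoning

  -- W j takes token j from its start to digit 4 and turns every phase by j; W↺ j turns every
  -- phase by k + 1, i.e. returns it, so the three W↺ j in W (suc j) add 3 to the digit of token
  -- j + 1 and leave the other tokens where they were.
  mutual
    W : ℕ → Word 2
    W zero    = b ∷ b ∷ b ∷ b ∷ []
    W (suc j) = W↺ j ++ W↺ j ++ W↺ j ++ W⁺ j

    W⁺ : ℕ → Word 2
    W⁺ j = W j ++ a ∷ b ∷ []

    W↺ : ℕ → Word 2
    W↺ j = W⁺ j ++ a^ (k ∸ j)

  high-path : ∀ j {p x} → 2 ≤ p → j + p ≤ k → x < 4 → (p , x) ⟶[ W j ] (j + p , x)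
  high-path zero 2≤p p≤k x<4 = stay ◅ stay ◅ stay ◅ stay ◅ ε
    where stay = b-stay 2≤p (encodable-top p≤k x<4)
  high-path (suc j) {p} {x} 2≤p j+p<k x<4 = loop ◅◅ loop ◅◅ loop ◅◅ forward
    where
    enc : Encodable (suc j + p , x)
    enc = encodable-top j+p<k x<4
    forward : (p , x) ⟶[ W⁺ j ] (suc j + p , x)
    forward = high-path j 2≤p (<⇒≤ j+p<k) x<4 ◅◅
              a-step j+p<k enc ◅ b-stay (≤-trans 2≤p (m≤n+m p (suc j))) enc ◅ ε
    turn : suc j + p + (k ∸ j) ≡ p + suc k
    turn = begin
      suc (j + p + (k ∸ j))   ≡⟨ cong (λ n → suc (n + (k ∸ j))) (+-comm j p) ⟩
      suc (p + j + (k ∸ j))   ≡⟨ cong suc (+-assoc p j (k ∸ j)) ⟩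
      suc (p + (j + (k ∸ j))) ≡⟨ cong (λ n → suc (p + n)) (m+[n∸m]≡n (m+n≤o⇒m≤o j (<⇒≤ j+p<k))) ⟩
      suc (p + k)             ≡⟨ +-suc p k ⟨
      p + suc k               ∎
      where open ≡-Reasoning
    loop : (p , x) ⟶[ W↺ j ] (p , x)
    loop = forward ◅◅ a^-path (k ∸ j) j+p<k x<4
             (trans (cong (_% suc k) turn) (%-full-turn (m+n≤o⇒n≤o (suc j) j+p<k)))

  startPhase : ℕ → ℕ
  startPhase zero    = 0
  startPhase (suc d) = k ∸ d

  start : ℕ → ℕ × ℕ
  start d = startPhase d , 0

  target : ℕ → ℕ × ℕ
  target zero    = 0 , 4
  target (suc e) = suc e , 0

  fill-path : ∀ d → d < k → start d ⟶[ W d ] target 0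
  fill-path zero    0<k = b-count 0<k z<s ◅ b-count 0<k (s<s z<s) ◅ b-count 0<k (s<s (s<s z<s)) ◅
                         b-count 0<k (n<1+n 3) ◅ ε
  fill-path (suc j) j<k = raise z<s ◅◅ raise (s<s z<s) ◅◅ raise (n<1+n 2) ◅◅ forward (n<1+n 3)
    where
    j≤k : j ≤ k
    j≤k = <⇒≤ (m+n≤o⇒n≤o 1 j<k)
    j+[k∸j]≡k : j + (k ∸ j) ≡ k
    j+[k∸j]≡k = m+[n∸m]≡n j≤k
    2≤k∸j : 2 ≤ k ∸ j
    2≤k∸j = subst (_≤ k ∸ j) (m+n∸n≡m 2 j) (∸-monoˡ-≤ j j<k)
    forward : ∀ {x} → x < 4 → (k ∸ j , x) ⟶[ W⁺ j ] (0 , suc x)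
    forward {x} x<4 = (high-path j 2≤k∸j (≤-reflexive j+[k∸j]≡k) x<4 ▸ cong (_, x) j+[k∸j]≡k) ◅◅
                      a-wrap x<4 ◅ b-count (<-trans z<s j<k) x<4 ◅ ε
    raise : ∀ {x} → x < 3 → (k ∸ j , x) ⟶[ W↺ j ] (k ∸ j , suc x)
    raise x<3 = forward (m<n⇒m<1+n x<3) ◅◅ a^-path (k ∸ j) z≤n (s≤s x<3) (m≤n⇒m%n≡m (m∸n≤m k j))

  target-step : ∀ e → suc e < k → target e ⟶[ a ∷ b ∷ [] ] target (suc e)
  target-step zero    1<k = a-step (<⇒≤ 1<k) (encodable-below 1<k (n<1+n 4)) ◅ b-reset (<⇒≤ 1<k) ◅ ε
  target-step (suc e) e+2<k = a-step (<⇒≤ e+2<k) enc ◅ b-stay (s≤s (s≤s z≤n)) enc ◅ ε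
    where enc = encodable-top (<⇒≤ e+2<k) z<s

  return-phase : ∀ e d → suc e + d ≤ k → (suc e + (k ∸ (e + d))) % suc k ≡ startPhase d
  return-phase e zero e<k = begin
    suc (e + (k ∸ (e + 0))) % suc k ≡⟨ cong (λ n → suc (e + (k ∸ n)) % suc k) (+-identityʳ e) ⟩
    suc (e + (k ∸ e)) % suc k       ≡⟨ cong (λ n → suc n % suc k) (m+[n∸m]≡n (m+n≤o⇒m≤o e (<⇒≤ e<k))) ⟩
    suc k % suc k                   ≡⟨ n%n≡0 (suc k) ⟩
    0                               ∎
    where open ≡-Reasoning
  return-phase e (suc d) e+1+d<k = begin
    (suc e + (k ∸ (e + suc d))) % suc k ≡⟨ cong (_% suc k) (+-∸-assoc (suc e) (<⇒≤ e+1+d<k)) ⟨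
    (suc e + k ∸ (e + suc d)) % suc k   ≡⟨ cong (λ n → (suc e + k ∸ n) % suc k) (+-suc e d) ⟩
    (suc e + k ∸ (suc e + d)) % suc k   ≡⟨ cong (_% suc k) ([m+n]∸[m+o]≡n∸o (suc e) k d) ⟩
    (k ∸ d) % suc k                     ≡⟨ m≤n⇒m%n≡m (m∸n≤m k d) ⟩
    k ∸ d                               ∎
    where open ≡-Reasoning

  token-path : ∀ e d → e + d < k → start d ⟶[ W (e + d) ] target e
  token-path zero    d d<k     = fill-path d d<k
  token-path (suc e) d e+d+1<k = loop ◅◅ loop ◅◅ loop ◅◅ forward
    where
    forward : start d ⟶[ W⁺ (e + d) ] target (suc e)
    forward = token-path e d (<⇒≤ e+d+1<k) ◅◅ target-step e (m+n≤o⇒m≤o (suc (suc e)) e+d+1<k)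
    loop : start d ⟶[ W↺ (e + d) ] start d
    loop = forward ◅◅ a^-path (k ∸ (e + d)) (m+n≤o⇒m≤o (suc e) (<⇒≤ e+d+1<k)) z<s
                        (return-phase e d (<⇒≤ e+d+1<k))

  data b-Step : ℕ × ℕ → ℕ × ℕ → Set where
    count : ∀ {x} → b-Step (0 , x) (0 , suc x)
    reset : b-Step (1 , 4) (1 , 0)
    stay  : ∀ {p x} → b-Step (suc (suc p) , x) (suc (suc p) , x)

  b-inversion : ∀ s {t} → δ₀ s b ≡ just t → b-Step s t
  b-inversion (0 , x) _ with x <? 4
  b-inversion (0 , x) refl | yes _ = count
  b-inversion (1 , x) _ with x ≟ 4
  b-inversion (1 , .4) refl | yes refl = reset
  b-inversion (suc (suc p) , x) refl = stay

  b-Step-phase : ∀ {s t} → b-Step s t → phase t ≡ phase s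
  b-Step-phase count = refl
  b-Step-phase reset = refl
  b-Step-phase stay  = refl

  b-Step-digit : ∀ {s t} → b-Step s t → digit t ≤ suc (digit s)
  b-Step-digit count = ≤-refl
  b-Step-digit reset = z≤n
  b-Step-digit stay  = n≤1+n _

  b-Step-digit-off-0 : ∀ {s t} → b-Step s t → phase s ≢ 0 → digit t ≤ digit s
  b-Step-digit-off-0 count p≢0 = contradiction refl p≢0
  b-Step-digit-off-0 reset _   = z≤n
  b-Step-digit-off-0 stay  _   = ≤-refl

  b-Step-at-1 : ∀ {s t} → b-Step s t → phase s ≡ 1 → digit s ≡ 4 × digit t ≡ 0
  b-Step-at-1 reset _ = refl , refl

  Aligned : ℕ → (ℕ → ℕ × ℕ) → Set
  Aligned c ss = ∀ j → j < k → (phase (ss j) + j) % suc k ≡ c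

  potential : (ℕ → ℕ × ℕ) → ℕ
  potential ss = weightedSum 4 k (digit ∘ ss)

  at-phase-0⇒index≡c : ∀ {j c} → j < k → (0 + j) % suc k ≡ c → j ≡ c
  at-phase-0⇒index≡c j<k j%≡c = trans (sym (m≤n⇒m%n≡m (<⇒≤ j<k))) j%≡c

  index+1≡c⇒phase≡1 : ∀ {p j} → p ≤ k → j < k → (p + j) % suc k ≡ suc j → p ≡ 1
  index+1≡c⇒phase≡1 {p} {j} p≤k j<k p+j%≡1+j with %-wrap (+-mono-< (s≤s p≤k) (m<n⇒m<1+n j<k))
  ... | inj₁ p+j%≡p+j = +-cancelʳ-≡ j p 1 (trans (sym p+j%≡p+j) p+j%≡1+j)
  ... | inj₂ p+j%+k+1≡p+j =
    contradiction (trans (cong (_+ suc k) (sym p+j%≡1+j)) p+j%+k+1≡p+j) (≢-sym (<⇒≢ p+j<))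
    where
    p+j< : p + j < suc j + suc k
    p+j< = begin-strict
      p + j     ≤⟨ +-monoˡ-≤ j p≤k ⟩
      k + j     ≡⟨ +-comm k j ⟩
      j + k     <⟨ +-monoʳ-< j (n<1+n k) ⟩
      j + suc k <⟨ n<1+n _ ⟩
      suc j + suc k ∎
      where open ≤-Reasoning

  module _ {c} {ss ss′ : ℕ → ℕ × ℕ} (aligned : Aligned c ss) where

    a-preserves : (∀ j → j < k → δ₀ (ss j) a ≡ just (ss′ j)) →
                  Aligned (rotate c) ss′ × potential ss′ ≤ potential ss
    a-preserves steps = aligned′ , weightedSum-mono k (λ j j<k → ≤-reflexive (cong digit (ss′≡ j j<k)))
      where
      ss′≡ : ∀ j → j < k → ss′ j ≡ (rotate (phase (ss j)) , digit (ss j))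
      ss′≡ j j<k = sym (just-injective (steps j j<k))
      aligned′ : Aligned (rotate c) ss′
      aligned′ j j<k = begin
        (phase (ss′ j) + j) % suc k        ≡⟨ cong (λ p → (phase p + j) % suc k) (ss′≡ j j<k) ⟩
        (rotate (phase (ss j)) + j) % suc k ≡⟨ %-absorbˡ (suc (phase (ss j))) j (suc k) ⟩
        rotate (phase (ss j) + j)           ≡⟨ %-absorbʳ 1 (phase (ss j) + j) (suc k) ⟨
        rotate ((phase (ss j) + j) % suc k) ≡⟨ cong rotate (aligned j j<k) ⟩
        rotate c                            ∎
        where open ≡-Reasoning

    b-preserves : (∀ j → j < k → phase (ss j) ≤ k) → (∀ j → j < k → δ₀ (ss j) b ≡ just (ss′ j)) →
                  Aligned c ss′ × potential ss′ ≤ potential ss + 1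
    b-preserves bounded steps = aligned′ , weightedSum-carry
      (λ j j<k → b-Step-digit (inv j j<k))
      (λ j j<k j≢c → b-Step-digit-off-0 (inv j j<k) (λ p≡0 → j≢c (at-phase-0⇒index≡c j<k (phase≡0 j j<k p≡0))))
      (λ c′ 1+c′≡c c′<k → b-Step-at-1 (inv c′ c′<k)
         (index+1≡c⇒phase≡1 (bounded c′ c′<k) c′<k (trans (aligned c′ c′<k) (sym 1+c′≡c))))
      where
      inv : ∀ j → j < k → b-Step (ss j) (ss′ j)
      inv j j<k = b-inversion (ss j) (steps j j<k)
      phase≡0 : ∀ j → j < k → phase (ss j) ≡ 0 → (0 + j) % suc k ≡ c
      phase≡0 j j<k p≡0 = trans (cong (λ p → (p + j) % suc k) (sym p≡0)) (aligned j j<k)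
      aligned′ : Aligned c ss′
      aligned′ j j<k = trans (cong (λ p → (p + j) % suc k) (b-Step-phase (inv j j<k))) (aligned j j<k)

  letter-step : ∀ l {c ss ss′} → (∀ j → j < k → phase (ss j) ≤ k) → Aligned c ss →
                (∀ j → j < k → δ₀ (ss j) l ≡ just (ss′ j)) →
                ∃ λ c′ → Aligned c′ ss′ × potential ss′ ≤ potential ss + 1
  letter-step a _       aligned steps with a-preserves aligned steps
  ... | aligned′ , stays = _ , aligned′ , ≤-trans stays (m≤m+n _ 1)
  letter-step b bounded aligned steps = _ , b-preserves aligned bounded steps

  potential-growth : ∀ u {c} (qs rs : ℕ → Fin N) → Aligned c (decode ∘ qs) →
                     (∀ j → j < k → δ* automaton (qs j) u ≡ just (rs j)) →
                     potential (decode ∘ rs) ≤ potential (decode ∘ qs) + length u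
  potential-growth [] qs rs _ runs =
    ≤-trans (weightedSum-mono k λ j j<k → ≤-reflexive (cong (digit ∘ decode) (just-injective (sym (runs j j<k)))))
            (m≤m+n _ 0)
  potential-growth (l ∷ u) qs rs aligned runs = begin
    potential (decode ∘ rs)                 ≤⟨ potential-growth u qs′ rs (proj₁ (proj₂ step))
                                                                  (λ j j<k → proj₂ (split j j<k)) ⟩
    potential (decode ∘ qs′) + length u      ≤⟨ +-monoˡ-≤ (length u) (proj₂ (proj₂ step)) ⟩
    potential (decode ∘ qs) + 1 + length u   ≡⟨ +-assoc (potential (decode ∘ qs)) 1 (length u) ⟩
    potential (decode ∘ qs) + suc (length u) ∎
    where
    open ≤-Reasoning
    qs′ : ℕ → Fin N
    qs′ = next automaton l ∘ qs
    split : ∀ j → j < k → δ automaton (qs j) l ≡ just (qs′ j) × δ* automaton (qs′ j) u ≡ just (rs j)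
    split j j<k = δ*-∷⁻¹ {A = automaton} (qs j) l (runs j j<k)
    step : ∃ λ c′ → Aligned c′ (decode ∘ qs′) × potential (decode ∘ qs′) ≤ potential (decode ∘ qs) + 1
    step = letter-step l (λ j _ → decode-phase-≤ (qs j)) aligned
                         (λ j j<k → decode-δ (qs j) l (proj₁ (split j j<k)))

  startPhase-≤ : ∀ d → startPhase d ≤ k
  startPhase-≤ zero    = z≤n
  startPhase-≤ (suc d) = m∸n≤m k d

  start-encodable : ∀ d → Encodable (start d)
  start-encodable d = encodable-top (startPhase-≤ d) z<s

  target-encodable : ∀ e → e < k → Encodable (target e)
  target-encodable zero    0<k   = encodable-below 0<k (n<1+n 4)
  target-encodable (suc e) e+1<k = encodable-top (<⇒≤ e+1<k) z<s

  W-path : ∀ {d j} → d ≤ j → j < k → start d ⟶[ W j ] target (j ∸ d)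
  W-path {d} {j} d≤j j<k = subst (λ i → start d ⟶[ W i ] target (j ∸ d)) j∸d+d≡j
                             (token-path (j ∸ d) d (subst (_< k) (sym j∸d+d≡j) j<k))
    where
    j∸d+d≡j : j ∸ d + d ≡ j
    j∸d+d≡j = m∸n+n≡m d≤j

  start-aligned : Aligned 0 start
  start-aligned zero    _   = refl
  start-aligned (suc d) d<k = begin
    (k ∸ d + suc d) % suc k ≡⟨ cong (_% suc k) (+-suc (k ∸ d) d) ⟩
    suc (k ∸ d + d) % suc k ≡⟨ cong (λ n → suc n % suc k) (m∸n+n≡m (<⇒≤ (m+n≤o⇒n≤o 1 d<k))) ⟩
    suc k % suc k           ≡⟨ n%n≡0 (suc k) ⟩
    0                       ∎
    where open ≡-Reasoning

  length-≥-potential : ∀ {u} (qs rs : ℕ → Fin N) → (∀ j → decode (qs j) ≡ start j) →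
                       (∀ j → j < k → δ* automaton (qs j) u ≡ just (rs j)) →
                       potential (decode ∘ rs) ≤ length u
  length-≥-potential {u} qs rs qs≡start runs = begin
    potential (decode ∘ rs)            ≤⟨ potential-growth u qs rs aligned runs ⟩
    potential (decode ∘ qs) + length u ≡⟨ cong (_+ length u) (weightedSum-zero k λ j _ → cong digit (qs≡start j)) ⟩
    length u                           ∎
    where
    open ≤-Reasoning
    aligned : Aligned 0 (decode ∘ qs)
    aligned j j<k = trans (cong (λ s → (phase s + j) % suc k) (qs≡start j)) (start-aligned j j<k)

maxDiam-≥ : ∀ k₀ → MaxDiamAtLeast (5 * suc k₀ + 4) 2 (4 ^ suc k₀)
maxDiam-≥ k₀ = automaton , W k₀ , depth
  where
  open Construction (suc k₀)
  final-encodable : ∀ d → Encodable (target (k₀ ∸ d))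
  final-encodable d = target-encodable (k₀ ∸ d) (s≤s (m∸n≤m k₀ d))
  qs rs : ℕ → Fin N
  qs d = proj₁ (start-encodable d)
  rs d = proj₁ (final-encodable d)
  W-runs : ∀ d → d < suc k₀ → δ* automaton (qs d) (W k₀) ≡ just (rs d)
  W-runs d d<k =
    ⟶⇒δ* (W-path (s≤s⁻¹ d<k) ≤-refl) (proj₂ (start-encodable d)) (proj₂ (final-encodable d))
  last-digit : digit (decode (rs k₀)) ≡ 4
  last-digit = cong digit (trans (decode-encode (proj₂ (final-encodable k₀))) (cong target (n∸n≡0 k₀)))
  depth : DepthAtLeast automaton (⟦ automaton ⟧ (W k₀)) (4 ^ suc k₀)
  depth u expresses = begin
    4 ^ suc k₀                      ≡⟨ cong (_* 4 ^ k₀) last-digit ⟨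
    digit (decode (rs k₀)) * 4 ^ k₀ ≤⟨ m≤n+m _ _ ⟩
    potential (decode ∘ rs)         ≤⟨ length-≥-potential {u} qs rs
                                         (λ d → decode-encode (proj₂ (start-encodable d)))
                                         (λ d d<k → trans (expresses (qs d)) (W-runs d d<k)) ⟩
    length u                        ∎
    where open ≤-Reasoning

corollary1 : ∀ (n k : ℕ) → 9 ≤ n → n ≡ 5 * k + 4 →
    MaxDiamAtLeast n 2 (4 ^ k)
corollary1 _ zero    (s≤s (s≤s (s≤s (s≤s (s≤s _))))) ()
corollary1 _ (suc k) _ refl = maxDiam-≥ k
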